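{- For $0<\gamma\leqslant 1$ define $$g(\gamma):=\limsup_{n\to\infty}\frac{e_{\lfloor \gamma n\rfloor}(n)}{n}.$$ Then: (1) for $0<\gamma\leqslant 1/2$ we have $2\gamma\leqslant g(\gamma)\leqslant 1$; (2) for $1/2<\gamma\leqslant 1$ we have $g(\gamma)=0$.
   Context: For $n\geqslant 1$, $Q_n$ denotes the $n$-dimensional hypercube: its vertices are all binary sequences $x=(x_i)_{i=1,\dots,n}$, and it is equipped with the Hamming distance $\rho(x,y)=|\{i : x_i\neq y_i\}|$ (the shortest-path metric of the hypercube graph). For a positive integer $d$, a non-empty subset $S\subseteq Q_n$ is called $d$-equilateral if $\rho(x,y)=d$ for all distinct $x,y\in S$. $e_d(n)$ denotes the maximal cardinality of a $d$-equilateral subset of $Q_n$ (so $e_d(n)=1$ if $d>n$). -}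

module Defs where

open import Data.Nat using (ℕ; zero; suc; _⊔_; _≤_)
open import Data.Nat as ℕ using ()
open import Data.Bool using (Bool; true; false)
open import Data.Bool.Properties using () renaming (_≟_ to _≟ᵇ_)
open import Data.Vec using (Vec; []; _∷_)
open import Data.List using (List; []; _∷_; _++_; map; length; filter; foldr)
open import Data.List.Relation.Unary.AllPairs using (AllPairs; allPairs?)
open import Data.Integer using (+_)
open import Data.Rational using (ℚ; _/_; _<_; _*_; ½; 0ℚ; 1ℚ)
open import Data.Product using (∃; _×_)
open import Relation.Nullary using (¬_; yes; no)
open import Level using (0ℓ)

ham : ∀ {n} → Vec Bool n → Vec Bool n → ℕ
ham [] [] = 0
ham (a ∷ x) (b ∷ y) with a ≟ᵇ b
... | yes _ = ham x y
... | no  _ = suc (ham x y)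

allVecs : (n : ℕ) → List (Vec Bool n)
allVecs zero = [] ∷ []
allVecs (suc n) = map (true ∷_) (allVecs n) ++ map (false ∷_) (allVecs n)

-- All sublists (subsequences) of a list; applied to allVecs n these are
-- exactly all subsets of Q_n.
sublists : ∀ {A : Set} → List A → List (List A)
sublists [] = [] ∷ []
sublists (x ∷ xs) = map (x ∷_) (sublists xs) ++ sublists xs

Equilateral : ∀ {n} → ℕ → List (Vec Bool n) → Set
Equilateral d S = AllPairs (λ x y → ham x y ≡ d) S
  where open import Relation.Binary.PropositionalEquality using (_≡_)

-- e_d(n): the maximal cardinality of a d-equilateral subset of Q_n
-- (singletons are always d-equilateral, so this is ≥ 1; the empty set
-- contributes 0 and does not affect the maximum).
e : ℕ → ℕ → ℕ
e d n = foldr _⊔_ 0 (map length (filter (allPairs? (λ x y → ham x y ℕ.≟ d)) (sublists (allVecs n))))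

-- Real numbers as (classical) Dedekind lower cuts:
-- Lower q  means  q < γ.

record Real : Set₁ where
  field
    Lower      : ℚ → Set
    inhabited  : ∃ Lower
    bounded    : ∃ (λ q → ¬ Lower q)
    downClosed : ∀ {p q} → p < q → Lower q → Lower p
    rounded    : ∀ {q} → Lower q → ∃ (λ r → q < r × Lower r)
open Real public

-- k is the floor of γ·n  (n ≥ 1):  k/n ≤ γ < (k+1)/n.
IsFloorMul : Real → (n : ℕ) → .{{_ : ℕ.NonZero n}} → ℕ → Set
IsFloorMul γ n k =
  (∀ q → q < (+ k / n) → Lower γ q)
  × ∃ (λ q → q < (+ suc k / n) × ¬ Lower γ q)

-- x : ℕ → ℚ a sequence; Below : ℚ → Set the lower cut { r | r < c } of c.
-- limsup x ≥ c :  for every r < c, x n > r for infinitely many n.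
LimsupGE : (ℕ → ℚ) → (ℚ → Set) → Set
LimsupGE x Below = ∀ r → Below r → ∀ N → ∃ (λ n → N ≤ n × r < x n)

LimsupLE : (ℕ → ℚ) → ℚ → Set
LimsupLE x c = ∀ r → c < r → ∃ (λ N → ∀ n → N ≤ n → x n < r)

-- The sequence  e_{⌊γn⌋}(n)/n, indexed so that  ratioSeq d m  is the term
-- for n = m + 1 (here d n plays the role of ⌊γ n⌋).
ratioSeq : (ℕ → ℕ) → ℕ → ℚ
ratioSeq d m = + e (d (suc m)) (suc m) / suc m

module Submission where

-- Embed Qₙ in ℤⁿ by x ↦ (±1)ᵢ, so that ⟨x, y⟩ = n − 2ρ(x, y).  For a d-equilateral
-- family the Gram identity  ‖Σ cⱼ xⱼ‖² = 2d Σ cⱼ² + (n − 2d)(Σ cⱼ)²  (SignVectors) gives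
--   * the rank bound: for 1 ≤ d ≤ n/2 the points are linearly independent, so there are at
--     most n of them, since more than n vectors of ℤⁿ are dependent (IntegerDependence);
--   * Plotkin's bound 2dE ≤ 2d + nE for a family of E points  (both in EquilateralBounds).
-- EquilateralSize links the enumerative definition of e to equilateral lists, and Sylvester's
-- Hadamard matrices give e_{2^t}(n) ≥ 2^(t+1) for n ≥ 2^(t+1) (Sylvester).  Writing k = ⌊γn⌋,
-- FloorSequence derives the asymptotics: for γ ≤ ½ the rank bound gives e_k(n) ≤ n, and as k
-- grows in unit steps it hits every power of two, where e_k(n)/n ≥ 2k/n → 2γ; for γ > ½ the
-- excess 2k − n is a positive proportion of n, so Plotkin's bound keeps e_k(n) bounded.

open import Defs
open import Data.Nat using (ℕ; suc)

module SignVectors where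

  open import Data.Integer using (ℤ; +_; -[1+_]; _+_; _*_; _-_)
  open import Data.Nat.Properties using (suc-injective)
  open import Data.Integer.Properties using (+-*-semiring; *-zeroʳ; +-identityʳ)
  open import Data.Integer.Tactic.RingSolver using (solve-∀)
  open import Algebra.Properties.Semiring.Sum +-*-semiring
    using (sum; sum-cong-≗; ∑-distrib-+; *-distribˡ-sum; sum-replicate-zero)
  open import Data.Bool using (Bool; true; false)
  open import Data.Fin using (Fin)
  open import Data.Vec using (Vec; []; _∷_; lookup)
  open import Data.List using (List; []; _∷_; length; map)
  open import Data.List.Relation.Unary.All using (All; []; _∷_)
  open import Data.List.Relation.Unary.AllPairs using ([]; _∷_)
  open import Relation.Binary.PropositionalEquality
  open ≡-Reasoning

  ±1 : Bool → ℤ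
  ±1 true  = + 1
  ±1 false = -[1+ 0 ]

  embed : ∀ {n} → Vec Bool n → Fin n → ℤ
  embed x i = ±1 (lookup x i)

  ⟨_,_⟩ : ∀ {n} → (Fin n → ℤ) → (Fin n → ℤ) → ℤ
  ⟨ u , v ⟩ = sum (λ i → u i * v i)

  ham-self : ∀ {n} (x : Vec Bool n) → ham x x ≡ 0
  ham-self []          = refl
  ham-self (true ∷ x)  = ham-self x
  ham-self (false ∷ x) = ham-self x

  ham-sym : ∀ {n} (x y : Vec Bool n) → ham x y ≡ ham y x
  ham-sym []          []          = refl
  ham-sym (true ∷ x)  (true ∷ y)  = ham-sym x y
  ham-sym (true ∷ x)  (false ∷ y) = cong suc (ham-sym x y)
  ham-sym (false ∷ x) (true ∷ y)  = cong suc (ham-sym x y)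
  ham-sym (false ∷ x) (false ∷ y) = ham-sym x y

  -- One more coordinate on which the two points agree, resp. disagree.
  private
    agree : ∀ {s} m h → s ≡ m - + 2 * h → + 1 + s ≡ (+ 1 + m) - + 2 * h
    agree m h refl = shift m h
      where shift : ∀ m h → + 1 + (m - + 2 * h) ≡ (+ 1 + m) - + 2 * h
            shift = solve-∀
    disagree : ∀ {s} m h → s ≡ m - + 2 * h → -[1+ 0 ] + s ≡ (+ 1 + m) - + 2 * (+ 1 + h)
    disagree m h refl = shift m h
      where shift : ∀ m h → -[1+ 0 ] + (m - + 2 * h) ≡ (+ 1 + m) - + 2 * (+ 1 + h)
            shift = solve-∀

  -- Inner products of embedded points only see the Hamming distance:
  -- agreeing coordinates contribute +1, disagreeing ones -1.
  inner-embed : ∀ {n} (x y : Vec Bool n) → ⟨ embed x , embed y ⟩ ≡ + n - + 2 * + ham x y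
  inner-embed         []          []          = refl
  inner-embed {suc n} (true ∷ x)  (true ∷ y)  = agree (+ n) (+ ham x y) (inner-embed x y)
  inner-embed {suc n} (false ∷ x) (false ∷ y) = agree (+ n) (+ ham x y) (inner-embed x y)
  inner-embed {suc n} (true ∷ x)  (false ∷ y) = disagree (+ n) (+ ham x y) (inner-embed x y)
  inner-embed {suc n} (false ∷ x) (true ∷ y)  = disagree (+ n) (+ ham x y) (inner-embed x y)

  inner-embed-self : ∀ {n} (x : Vec Bool n) → ⟨ embed x , embed x ⟩ ≡ + n
  inner-embed-self {n} x = begin
    ⟨ embed x , embed x ⟩    ≡⟨ inner-embed x x ⟩
    + n - + 2 * + ham x x    ≡⟨ cong (λ h → + n - + 2 * + h) (ham-self x) ⟩
    + n - + 2 * + 0          ≡⟨ +-identityʳ (+ n) ⟩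
    + n                      ∎

  inner-linearʳ : ∀ {n} (u v w : Fin n → ℤ) c → ⟨ u , (λ i → c * v i + w i) ⟩ ≡ c * ⟨ u , v ⟩ + ⟨ u , w ⟩
  inner-linearʳ u v w c = begin
    sum (λ i → u i * (c * v i + w i))         ≡⟨ sum-cong-≗ (λ i → distrib (u i) c (v i) (w i)) ⟩
    sum (λ i → c * (u i * v i) + u i * w i)   ≡⟨ ∑-distrib-+ (λ i → c * (u i * v i)) (λ i → u i * w i) ⟩
    sum (λ i → c * (u i * v i)) + ⟨ u , w ⟩   ≡⟨ cong (_+ ⟨ u , w ⟩) (*-distribˡ-sum c (λ i → u i * v i)) ⟨
    c * ⟨ u , v ⟩ + ⟨ u , w ⟩                 ∎
    where distrib : ∀ a c b w → a * (c * b + w) ≡ c * (a * b) + a * w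
          distrib = solve-∀

  inner-zeroʳ : ∀ {n} (u : Fin n → ℤ) → ⟨ u , (λ _ → + 0) ⟩ ≡ + 0
  inner-zeroʳ {n} u = trans (sum-cong-≗ (λ i → *-zeroʳ (u i))) (sum-replicate-zero n)

  inner-vanishing : ∀ {n} (v : Fin n → ℤ) → (∀ i → v i ≡ + 0) → ⟨ v , v ⟩ ≡ + 0
  inner-vanishing v v≡0 = trans (sum-cong-≗ (λ i → cong (v i *_) (v≡0 i))) (inner-zeroʳ v)

  inner-square : ∀ {n} (v w : Fin n → ℤ) c →
    ⟨ (λ i → c * v i + w i) , (λ i → c * v i + w i) ⟩ ≡ c * c * ⟨ v , v ⟩ + + 2 * c * ⟨ v , w ⟩ + ⟨ w , w ⟩
  inner-square v w c = begin
    sum (λ i → (c * v i + w i) * (c * v i + w i))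
      ≡⟨ sum-cong-≗ (λ i → expand c (v i) (w i)) ⟩
    sum (λ i → c * c * (v i * v i) + + 2 * c * (v i * w i) + w i * w i)
      ≡⟨ ∑-distrib-+ (λ i → c * c * (v i * v i) + + 2 * c * (v i * w i)) (λ i → w i * w i) ⟩
    sum (λ i → c * c * (v i * v i) + + 2 * c * (v i * w i)) + ⟨ w , w ⟩
      ≡⟨ cong (_+ ⟨ w , w ⟩) (∑-distrib-+ (λ i → c * c * (v i * v i)) (λ i → + 2 * c * (v i * w i))) ⟩
    sum (λ i → c * c * (v i * v i)) + sum (λ i → + 2 * c * (v i * w i)) + ⟨ w , w ⟩
      ≡⟨ cong₂ (λ a b → a + b + ⟨ w , w ⟩) (*-distribˡ-sum (c * c) (λ i → v i * v i))
                                          (*-distribˡ-sum (+ 2 * c) (λ i → v i * w i)) ⟨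
    c * c * ⟨ v , v ⟩ + + 2 * c * ⟨ v , w ⟩ + ⟨ w , w ⟩
      ∎
    where expand : ∀ c a b → (c * a + b) * (c * a + b) ≡ c * c * (a * a) + + 2 * c * (a * b) + b * b
          expand = solve-∀

  -- Linear combinations Σ cⱼ vⱼ; coefficients and vectors are zipped, so
  -- statements about them carry the hypothesis that the lengths agree.
  lincomb : ∀ {n} → List ℤ → List (Fin n → ℤ) → Fin n → ℤ
  lincomb []       _        i = + 0
  lincomb (c ∷ cs) []       i = + 0
  lincomb (c ∷ cs) (v ∷ vs) i = c * v i + lincomb cs vs i

  Σ : List ℤ → ℤ
  Σ []       = + 0
  Σ (c ∷ cs) = c + Σ cs

  Σ² : List ℤ → ℤ
  Σ² []       = + 0
  Σ² (c ∷ cs) = c * c + Σ² cs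

  inner-equidistant : ∀ {n} d (x : Vec Bool n) cs ys → length cs ≡ length ys →
    All (λ y → ham x y ≡ d) ys → ⟨ embed x , lincomb cs (map embed ys) ⟩ ≡ (+ n - + 2 * + d) * Σ cs
  inner-equidistant {n} d x [] [] _ [] = trans (inner-zeroʳ (embed x)) (sym (*-zeroʳ (+ n - + 2 * + d)))
  inner-equidistant {n} d x (c ∷ cs) (y ∷ ys) len (xy ∷ xys) = begin
    ⟨ embed x , lincomb (c ∷ cs) (map embed (y ∷ ys)) ⟩
      ≡⟨ inner-linearʳ (embed x) (embed y) (lincomb cs (map embed ys)) c ⟩
    c * ⟨ embed x , embed y ⟩ + ⟨ embed x , lincomb cs (map embed ys) ⟩
      ≡⟨ cong₂ (λ a b → c * a + b) (trans (inner-embed x y) (cong (λ h → + n - + 2 * + h) xy))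
                                   (inner-equidistant d x cs ys (suc-injective len) xys) ⟩
    c * m + m * Σ cs
      ≡⟨ factor c m (Σ cs) ⟩
    m * Σ (c ∷ cs)
      ∎
    where m = + n - + 2 * + d
          factor : ∀ c m s → c * m + m * s ≡ m * (c + s)
          factor = solve-∀

  gram : ∀ {n} d (xs : List (Vec Bool n)) cs → length cs ≡ length xs → Equilateral d xs →
    let w = lincomb cs (map embed xs) in
    ⟨ w , w ⟩ ≡ + 2 * + d * Σ² cs + (+ n - + 2 * + d) * (Σ cs * Σ cs)
  gram {n} d [] [] _ [] = trans (inner-zeroʳ {n} (λ _ → + 0)) (empty (+ n) (+ d))
    where empty : ∀ n d → + 0 ≡ + 2 * d * + 0 + (n - + 2 * d) * (+ 0 * + 0)
          empty = solve-∀
  gram {n} d (x ∷ xs) (c ∷ cs) len (px ∷ pxs) = begin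
    ⟨ w' , w' ⟩
      ≡⟨ inner-square (embed x) w c ⟩
    c * c * ⟨ embed x , embed x ⟩ + + 2 * c * ⟨ embed x , w ⟩ + ⟨ w , w ⟩
      ≡⟨ cong₂ _+_ (cong₂ (λ a b → c * c * a + + 2 * c * b) (inner-embed-self x)
                                                           (inner-equidistant d x cs xs len' px))
                   (gram d xs cs len' pxs) ⟩
    c * c * + n + + 2 * c * (m * Σ cs) + (+ 2 * + d * Σ² cs + m * (Σ cs * Σ cs))
      ≡⟨ regroup c (+ n) (+ d) (Σ² cs) (Σ cs) ⟩
    + 2 * + d * Σ² (c ∷ cs) + m * (Σ (c ∷ cs) * Σ (c ∷ cs))
      ∎
    where w    = lincomb cs (map embed xs)
          w'   = lincomb (c ∷ cs) (map embed (x ∷ xs))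
          m    = + n - + 2 * + d
          len' = suc-injective len
          regroup : ∀ c n d q s → c * c * n + + 2 * c * ((n - + 2 * d) * s) + (+ 2 * d * q + (n - + 2 * d) * (s * s))
                                ≡ + 2 * d * (c * c + q) + (n - + 2 * d) * ((c + s) * (c + s))
          regroup = solve-∀

module IntegerDependence where

  open SignVectors using (lincomb)
  open import Data.Nat as ℕ using (zero; s≤s)
  open import Data.Integer using (ℤ; +_; _+_; _*_; _-_; -_; _≟_)
  open import Data.Integer.Properties using (+-identityˡ; *-identityˡ; *-zeroʳ; *-assoc; *-distribˡ-+; i*j≡0⇒i≡0∨j≡0)
  open import Data.Integer.Tactic.RingSolver using (solve-∀)
  open import Data.Fin as Fin using (Fin; punchIn; punchOut)
  open import Data.Fin.Properties using (all?; ¬∀⟶∃¬; punchIn-punchOut)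
  open import Data.List using (List; []; _∷_; length; map; replicate)
  open import Data.List.Properties using (length-map; length-replicate)
  open import Data.List.Relation.Unary.Any as Any using (Any; here; there)
  open import Data.List.Relation.Unary.Any.Properties using (map⁺)
  open import Data.Product using (∃; _×_; _,_)
  open import Data.Sum using ([_,_])
  open import Relation.Nullary using (yes; no)
  open import Relation.Binary.PropositionalEquality hiding ([_])
  open ≡-Reasoning

  Dependent : ∀ {n} → List (Fin n → ℤ) → Set
  Dependent vs = ∃ λ cs → length cs ≡ length vs × Any (_≢ + 0) cs × (∀ i → lincomb cs vs i ≡ + 0)

  lincomb-zeros : ∀ {n} (vs : List (Fin n → ℤ)) i → lincomb (replicate (length vs) (+ 0)) vs i ≡ + 0
  lincomb-zeros []       i = refl
  lincomb-zeros (v ∷ vs) i = trans (+-identityˡ _) (lincomb-zeros vs i)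

  -- A family starting with the zero vector is dependent: take (1, 0, …, 0).
  zero-first : ∀ {n} (v : Fin n → ℤ) vs → (∀ i → v i ≡ + 0) → Dependent (v ∷ vs)
  zero-first v vs v≡0 =
    + 1 ∷ replicate (length vs) (+ 0) , cong suc (length-replicate (length vs)) , here (λ ()) ,
    λ i → cong₂ _+_ (trans (*-identityˡ (v i)) (v≡0 i)) (lincomb-zeros vs i)

  lincomb-scale : ∀ {n} a cs (ws : List (Fin n → ℤ)) i → lincomb (map (a *_) cs) ws i ≡ a * lincomb cs ws i
  lincomb-scale a []       ws       i = sym (*-zeroʳ a)
  lincomb-scale a (c ∷ cs) []       i = sym (*-zeroʳ a)
  lincomb-scale a (c ∷ cs) (w ∷ ws) i =
    trans (cong₂ _+_ (*-assoc a c (w i)) (lincomb-scale a cs ws i)) (sym (*-distribˡ-+ a _ _))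

  -- Gaussian elimination of the pivot coordinate p using v:  w ↦ v_p·w − w_p·v,
  -- viewed as a vector on the remaining n coordinates.
  eliminate : ∀ {n} (p : Fin (suc n)) (v w : Fin (suc n) → ℤ) → Fin n → ℤ
  eliminate p v w i = v p * w (punchIn p i) - w p * v (punchIn p i)

  private
    no-terms : ∀ a b → + 0 ≡ a * + 0 - + 0 * b
    no-terms = solve-∀

  lincomb-eliminate : ∀ {n} (p : Fin (suc n)) v cs ws (i : Fin n) →
    lincomb cs (map (eliminate p v) ws) i ≡ v p * lincomb cs ws (punchIn p i) - lincomb cs ws p * v (punchIn p i)
  lincomb-eliminate p v []       ws       i = no-terms (v p) (v (punchIn p i))
  lincomb-eliminate p v (c ∷ cs) []       i = no-terms (v p) (v (punchIn p i))
  lincomb-eliminate p v (c ∷ cs) (w ∷ ws) i =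
    trans (cong (_+_ (c * eliminate p v w i)) (lincomb-eliminate p v cs ws i))
          (collect (v p) c (w (punchIn p i)) (w p) (v (punchIn p i)) (lincomb cs ws (punchIn p i)) (lincomb cs ws p))
    where collect : ∀ a c wi wp vi L Lp → c * (a * wi - wp * vi) + (a * L - Lp * vi) ≡ a * (c * wi + L) - (c * wp + Lp) * vi
          collect = solve-∀

  -- The elimination step: a relation cs among the eliminated vectors lifts to the
  -- relation  (−Σ cⱼ wⱼ(p)) ∷ v_p·cs  among v ∷ ws; it stays nontrivial as v_p ≠ 0.
  lift-relation : ∀ {n} (p : Fin (suc n)) v ws → v p ≢ + 0 → Dependent (map (eliminate p v) ws) → Dependent (v ∷ ws)
  lift-relation p v ws vp≢0 (cs , len , nontrivial , relation) =
    - S ∷ map (v p *_) cs , length-ok , there (map⁺ (Any.map scaled≢0 nontrivial)) , vanishes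
    where
      S = lincomb cs ws p
      length-ok : length (- S ∷ map (v p *_) cs) ≡ length (v ∷ ws)
      length-ok = cong suc (trans (length-map (v p *_) cs) (trans len (length-map (eliminate p v) ws)))
      scaled≢0 : ∀ {c} → c ≢ + 0 → v p * c ≢ + 0
      scaled≢0 c≢0 vpc≡0 = [ vp≢0 , c≢0 ] (i*j≡0⇒i≡0∨j≡0 (v p) vpc≡0)
      at : ∀ i → lincomb (- S ∷ map (v p *_) cs) (v ∷ ws) i ≡ v p * lincomb cs ws i - S * v i
      at i = trans (cong (_+_ (- S * v i)) (lincomb-scale (v p) cs ws i)) (swap S (v i) (v p * lincomb cs ws i))
        where swap : ∀ s x y → - s * x + y ≡ y - s * x
              swap = solve-∀
      vanishes : ∀ i → lincomb (- S ∷ map (v p *_) cs) (v ∷ ws) i ≡ + 0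
      vanishes i with p Fin.≟ i
      ... | yes refl = trans (at p) (cancel (v p) S)
        where cancel : ∀ a s → a * s - s * a ≡ + 0
              cancel = solve-∀
      ... | no p≢i = begin
        lincomb (- S ∷ map (v p *_) cs) (v ∷ ws) i     ≡⟨ at i ⟩
        v p * lincomb cs ws i - S * v i                ≡⟨ cong (λ j → v p * lincomb cs ws j - S * v j) (punchIn-punchOut p≢i) ⟨
        v p * lincomb cs ws i' - S * v i'              ≡⟨ lincomb-eliminate p v cs ws (punchOut p≢i) ⟨
        lincomb cs (map (eliminate p v) ws) (punchOut p≢i) ≡⟨ relation (punchOut p≢i) ⟩
        + 0                                            ∎
        where i' = punchIn p (punchOut p≢i)

  -- More than n vectors in ℤⁿ admit a nontrivial integer relation
  -- (induction on n, eliminating one coordinate at a time).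
  dependent : ∀ n (vs : List (Fin n → ℤ)) → n ℕ.< length vs → Dependent vs
  dependent zero    (v ∷ vs) _ = zero-first v vs (λ ())
  dependent (suc n) (v ∷ vs) (s≤s n<) with all? (λ i → v i ≟ + 0)
  ... | yes v≡0 = zero-first v vs v≡0
  ... | no  v≢0 with ¬∀⟶∃¬ (suc n) (λ i → v i ≡ + 0) (λ i → v i ≟ + 0) v≢0
  ...   | p , vp≢0 = lift-relation p v vs vp≢0
                       (dependent n (map (eliminate p v) vs) (subst (n ℕ.<_) (sym (length-map (eliminate p v) vs)) n<))

module EquilateralBounds where

  open SignVectors
  open IntegerDependence using (dependent)
  open import Data.Nat as ℕ using (zero; _∸_; z≤n; s≤s)
  import Data.Nat.Properties as ℕP
  open import Data.Integer as ℤ using (ℤ; +_; -[1+_]; ∣_∣; _+_; _*_; _-_; +≤+)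
  open import Data.Integer.Properties using (pos-*; pos-+; +-injective; +-mono-≤; ∣i∣≡0⇒i≡0; 0≤i⇒+∣i∣≡i; m-n≡m⊖n; ⊖-≥)
  open import Data.Integer.Tactic.RingSolver using (solve-∀)
  open import Data.Bool using (Bool)
  open import Data.Fin using (Fin; zero; suc)
  open import Data.Vec using (Vec)
  open import Data.List using (List; []; _∷_; length; map; replicate)
  open import Data.List.Properties using (length-map; length-replicate)
  open import Data.List.Relation.Unary.Any using (Any; here; there)
  open import Data.Product using (_,_)
  open import Data.Empty using (⊥-elim)
  open import Relation.Nullary using (yes; no)
  open import Relation.Binary.PropositionalEquality
  open ≡-Reasoning

  -- Squares are natural numbers, so in particular ‖v‖² ≥ 0.
  square-abs : ∀ i → i * i ≡ + (∣ i ∣ ℕ.* ∣ i ∣)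
  square-abs (+ n)    = sym (pos-* n n)
  square-abs -[1+ n ] = refl

  inner-self-nonneg : ∀ {n} (v : Fin n → ℤ) → + 0 ℤ.≤ ⟨ v , v ⟩
  inner-self-nonneg {zero}  v = +≤+ z≤n
  inner-self-nonneg {suc n} v =
    +-mono-≤ (subst (+ 0 ℤ.≤_) (sym (square-abs (v zero))) (+≤+ z≤n)) (inner-self-nonneg (λ i → v (suc i)))

  Σ²ₙ : List ℤ → ℕ
  Σ²ₙ []       = 0
  Σ²ₙ (c ∷ cs) = ∣ c ∣ ℕ.* ∣ c ∣ ℕ.+ Σ²ₙ cs

  Σ²-abs : ∀ cs → Σ² cs ≡ + Σ²ₙ cs
  Σ²-abs []       = refl
  Σ²-abs (c ∷ cs) = trans (cong₂ _+_ (square-abs c) (Σ²-abs cs)) (sym (pos-+ (∣ c ∣ ℕ.* ∣ c ∣) (Σ²ₙ cs)))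

  Σ²ₙ-positive : ∀ {cs} → Any (_≢ + 0) cs → 1 ℕ.≤ Σ²ₙ cs
  Σ²ₙ-positive {c ∷ cs} (there nz) = ℕP.≤-trans (Σ²ₙ-positive nz) (ℕP.m≤n+m _ _)
  Σ²ₙ-positive {c ∷ cs} (here c≢0) with ∣ c ∣ in eq
  ... | zero  = ⊥-elim (c≢0 (∣i∣≡0⇒i≡0 eq))
  ... | suc _ = s≤s z≤n

  private
    cast-2d : ∀ d x → + (2 ℕ.* d ℕ.* x) ≡ + 2 * + d * + x
    cast-2d d x = trans (pos-* (2 ℕ.* d) x) (cong (_* + x) (pos-* 2 d))

  -- Otherwise the embedded points satisfy a nontrivial relation w = Σ cⱼ xⱼ = 0, but by
  -- the Gram identity ‖w‖² = 2d Σ cⱼ² + (n − 2d)(Σ cⱼ)² ≥ 2d > 0.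
  rank-bound : ∀ {n} d (xs : List (Vec Bool n)) → 1 ℕ.≤ d → 2 ℕ.* d ℕ.≤ n → Equilateral d xs → length xs ℕ.≤ n
  rank-bound {n} d xs 1≤d 2d≤n equilateral with n ℕ.<? length xs
  ... | no  n≮ = ℕP.≮⇒≥ n≮
  ... | yes n< with dependent n (map embed xs) (subst (n ℕ.<_) (sym (length-map embed xs)) n<)
  ...   | cs , len , nontrivial , relation = ⊥-elim (ℕP.<⇒≢ positive (+-injective zero≡))
    where
      w = lincomb cs (map embed xs)
      A = Σ²ₙ cs
      B = ∣ Σ cs ∣ ℕ.* ∣ Σ cs ∣
      positive : 0 ℕ.< 2 ℕ.* d ℕ.* A ℕ.+ (n ∸ 2 ℕ.* d) ℕ.* B
      positive = ℕP.≤-trans (s≤s z≤n) (ℕP.≤-trans (ℕP.*-mono-≤ (ℕP.*-monoʳ-≤ 2 1≤d) (Σ²ₙ-positive nontrivial)) (ℕP.m≤m+n _ _))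
      gap : + n - + 2 * + d ≡ + (n ∸ 2 ℕ.* d)
      gap = trans (cong (λ t → + n - t) (sym (pos-* 2 d))) (trans (m-n≡m⊖n n (2 ℕ.* d)) (⊖-≥ 2d≤n))
      zero≡ : + 0 ≡ + (2 ℕ.* d ℕ.* A ℕ.+ (n ∸ 2 ℕ.* d) ℕ.* B)
      zero≡ = begin
        + 0                                                      ≡⟨ inner-vanishing w relation ⟨
        ⟨ w , w ⟩                                                ≡⟨ gram d xs cs (trans len (length-map embed xs)) equilateral ⟩
        + 2 * + d * Σ² cs + (+ n - + 2 * + d) * (Σ cs * Σ cs)    ≡⟨ cong₂ _+_ (cong (_*_ (+ 2 * + d)) (Σ²-abs cs))
                                                                             (cong₂ _*_ gap (square-abs (Σ cs))) ⟩
        + 2 * + d * + A + + (n ∸ 2 ℕ.* d) * + B                  ≡⟨ cong₂ _+_ (cast-2d d A) (pos-* (n ∸ 2 ℕ.* d) B) ⟨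
        + (2 ℕ.* d ℕ.* A) + + ((n ∸ 2 ℕ.* d) ℕ.* B)              ≡⟨ pos-+ (2 ℕ.* d ℕ.* A) _ ⟨
        + (2 ℕ.* d ℕ.* A ℕ.+ (n ∸ 2 ℕ.* d) ℕ.* B)                ∎

  Σ-ones : ∀ E → Σ (replicate E (+ 1)) ≡ + E
  Σ-ones zero    = refl
  Σ-ones (suc E) = cong (_+_ (+ 1)) (Σ-ones E)

  Σ²-ones : ∀ E → Σ² (replicate E (+ 1)) ≡ + E
  Σ²-ones zero    = refl
  Σ²-ones (suc E) = cong (_+_ (+ 1)) (Σ²-ones E)

  -- Plotkin-type bound: a d-equilateral set of E points satisfies 2dE ≤ 2d + nE.
  -- With w = Σ xⱼ the Gram identity gives 0 ≤ ‖w‖² = 2dE + (n − 2d)E²; divide by E.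
  plotkin : ∀ {n} d (xs : List (Vec Bool n)) → Equilateral d xs →
    2 ℕ.* d ℕ.* length xs ℕ.≤ 2 ℕ.* d ℕ.+ n ℕ.* length xs
  plotkin {n} d [] _ = subst (ℕ._≤ 2 ℕ.* d ℕ.+ n ℕ.* 0) (sym (ℕP.*-zeroʳ (2 ℕ.* d))) z≤n
  plotkin {n} d xs@(_ ∷ _) equilateral =
    ℕP.*-cancelʳ-≤ (2 ℕ.* d ℕ.* E) (2 ℕ.* d ℕ.+ n ℕ.* E) E
      (subst (2 ℕ.* d ℕ.* E ℕ.* E ℕ.≤_) (+-injective balance) (ℕP.m≤n+m _ X))
    where
      E  = length xs
      cs = replicate E (+ 1)
      w  = lincomb cs (map embed xs)
      X  = ∣ ⟨ w , w ⟩ ∣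
      move : ∀ w d n E → w ≡ + 2 * d * E + (n - + 2 * d) * (E * E) → w + + 2 * d * E * E ≡ (+ 2 * d + n * E) * E
      move w d n E refl = regroup d n E
        where regroup : ∀ d n E → + 2 * d * E + (n - + 2 * d) * (E * E) + + 2 * d * E * E ≡ (+ 2 * d + n * E) * E
              regroup = solve-∀
      balance : + (X ℕ.+ 2 ℕ.* d ℕ.* E ℕ.* E) ≡ + ((2 ℕ.* d ℕ.+ n ℕ.* E) ℕ.* E)
      balance = begin
        + (X ℕ.+ 2 ℕ.* d ℕ.* E ℕ.* E)
          ≡⟨ pos-+ X _ ⟩
        + X + + (2 ℕ.* d ℕ.* E ℕ.* E)
          ≡⟨ cong₂ _+_ (0≤i⇒+∣i∣≡i (inner-self-nonneg w)) (trans (pos-* (2 ℕ.* d ℕ.* E) E) (cong (_* + E) (cast-2d d E))) ⟩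
        ⟨ w , w ⟩ + + 2 * + d * + E * + E
          ≡⟨ move ⟨ w , w ⟩ (+ d) (+ n) (+ E) (trans (gram d xs cs (length-replicate E) equilateral)
               (cong₂ (λ q s → + 2 * + d * q + (+ n - + 2 * + d) * (s * s)) (Σ²-ones E) (Σ-ones E))) ⟩
        (+ 2 * + d + + n * + E) * + E
          ≡⟨ cong (_* + E) (cong₂ _+_ (pos-* 2 d) (pos-* n E)) ⟨
        (+ (2 ℕ.* d) + + (n ℕ.* E)) * + E
          ≡⟨ trans (pos-* (2 ℕ.* d ℕ.+ n ℕ.* E) E) (cong (_* + E) (pos-+ (2 ℕ.* d) (n ℕ.* E))) ⟨
        + ((2 ℕ.* d ℕ.+ n ℕ.* E) ℕ.* E)
          ∎

module EquilateralSize where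

  open SignVectors using (ham-self; ham-sym)
  open import Data.Nat as ℕ using (zero; _≤_; _⊔_)
  open import Data.Nat.Properties using (⊔-sel; ≤-reflexive; m≤n⇒m≤n⊔o; m≤n⇒m≤o⊔n; <⇒≢)
  open import Data.Bool using (Bool; true; false)
  open import Data.Vec using (Vec; []; _∷_)
  open import Data.Vec.Properties using (∷-injectiveʳ; ≡-dec)
  open import Data.Bool.Properties using () renaming (_≟_ to _≟ᵇ_)
  open import Data.List using (List; []; _∷_; length; map; filter)
  open import Data.List.Properties using (foldr-preservesᵇ; foldr-preservesᵒ)
  open import Data.List.Membership.Propositional using (_∈_)
  open import Data.List.Membership.Propositional.Properties using (∈-map⁺; ∈-map⁻; ∈-++⁺ˡ; ∈-++⁺ʳ; ∈-filter⁺; ∈-filter⁻)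
  open import Data.List.Membership.Propositional.Properties.WithK using (unique∧set⇒bag)
  open import Data.List.Relation.Binary.BagAndSetEquality using (∼bag⇒↭)
  open import Data.List.Relation.Binary.Permutation.Propositional using (_↭_; ↭⇒↭ₛ)
  open import Data.List.Relation.Binary.Permutation.Propositional.Properties using (↭-length)
  import Data.List.Relation.Binary.Permutation.Setoid.Properties as Permutation
  open import Data.List.Relation.Unary.All as All using ([])
  open import Data.List.Relation.Unary.All.Properties using (all-filter) renaming (map⁺ to All-map⁺)
  open import Data.List.Relation.Unary.Any as Any using (here)
  open import Data.List.Relation.Unary.AllPairs as AllPairs using ([]; _∷_; allPairs?)
  open import Data.List.Relation.Unary.Unique.Propositional using (Unique)
  import Data.List.Relation.Unary.Unique.Propositional.Properties as Unique
  open import Data.Product using (∃; _×_; _,_; proj₂)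
  open import Data.Sum using (inj₁; inj₂; [_,_])
  open import Function.Bundles using (mk⇔)
  open import Relation.Nullary using (¬_; yes; no)
  open import Relation.Unary using (Decidable)
  open import Relation.Binary.PropositionalEquality hiding ([_])

  allVecs-complete : ∀ {n} (v : Vec Bool n) → v ∈ allVecs n
  allVecs-complete []          = here refl
  allVecs-complete (true ∷ v)  = ∈-++⁺ˡ (∈-map⁺ (true ∷_) (allVecs-complete v))
  allVecs-complete (false ∷ v) = ∈-++⁺ʳ _ (∈-map⁺ (false ∷_) (allVecs-complete v))

  allVecs-unique : ∀ n → Unique (allVecs n)
  allVecs-unique zero    = [] ∷ []
  allVecs-unique (suc n) =
    Unique.++⁺ (Unique.map⁺ ∷-injectiveʳ (allVecs-unique n)) (Unique.map⁺ ∷-injectiveʳ (allVecs-unique n)) disjoint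
    where
      disjoint : ∀ {v} → ¬ (v ∈ map (true ∷_) (allVecs n) × v ∈ map (false ∷_) (allVecs n))
      disjoint (t , f) with ∈-map⁻ (true ∷_) t | ∈-map⁻ (false ∷_) f
      ... | _ , _ , refl | _ , _ , ()

  filter∈sublists : ∀ {A : Set} {P : A → Set} (P? : Decidable P) xs → filter P? xs ∈ sublists xs
  filter∈sublists P? []       = here refl
  filter∈sublists P? (x ∷ xs) with P? x
  ... | yes _ = ∈-++⁺ˡ (∈-map⁺ (x ∷_) (filter∈sublists P? xs))
  ... | no  _ = ∈-++⁺ʳ _ (filter∈sublists P? xs)

  -- A duplicate-free list of vertices is a permutation of a sublist of allVecs n,
  -- namely of the vertices of allVecs n which it contains.
  as-sublist : ∀ {n} (S : List (Vec Bool n)) → Unique S → ∃ λ S' → S' ∈ sublists (allVecs n) × S ↭ S'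
  as-sublist {n} S unique =
    filter (_∈? S) (allVecs n) , filter∈sublists (_∈? S) (allVecs n) ,
    ∼bag⇒↭ (unique∧set⇒bag unique (Unique.filter⁺ (_∈? S) (allVecs-unique n))
             (λ {v} → mk⇔ (λ v∈S → ∈-filter⁺ (_∈? S) (allVecs-complete v) v∈S)
                  (λ v∈filter → proj₂ (∈-filter⁻ (_∈? S) {xs = allVecs n} v∈filter))))
    where open import Data.List.Membership.DecPropositional (≡-dec _≟ᵇ_) using (_∈?_)

  equilateral-unique : ∀ {n d} {S : List (Vec Bool n)} → 1 ≤ d → Equilateral d S → Unique S
  equilateral-unique 1≤d = AllPairs.map (λ {x} xy≡d x≡y → <⇒≢ 1≤d (trans (sym (ham-self x)) (trans (cong (ham x) x≡y) xy≡d)))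

  private
    equilateral? : ∀ {n} d → Decidable (Equilateral {n} d)
    equilateral? d = allPairs? (λ x y → ham x y ℕ.≟ d)

  e-attained : ∀ d n → ∃ λ (S : List (Vec Bool n)) → Equilateral d S × length S ≡ e d n
  e-attained d n = foldr-preservesᵇ {P = Realised} {f = _⊔_} join ([] , [] , refl)
    (All-map⁺ (All.map (λ {S} S-eq → S , S-eq , refl) (all-filter (equilateral? d) (sublists (allVecs n)))))
    where
      Realised : ℕ → Set
      Realised x = ∃ λ (S : List (Vec Bool n)) → Equilateral d S × length S ≡ x
      join : ∀ {x y} → Realised x → Realised y → Realised (x ⊔ y)
      join {x} {y} Sx Sy with ⊔-sel x y
      ... | inj₁ x⊔y≡x rewrite x⊔y≡x = Sx
      ... | inj₂ x⊔y≡y rewrite x⊔y≡y = Sy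

  e-maximal : ∀ d n (S : List (Vec Bool n)) → 1 ≤ d → Equilateral d S → length S ≤ e d n
  e-maximal d n S 1≤d S-eq with as-sublist S (equilateral-unique 1≤d S-eq)
  ... | S' , S'∈sublists , S↭S' =
    subst (_≤ e d n) (sym (↭-length S↭S'))
      (foldr-preservesᵒ (λ x y → [ m≤n⇒m≤n⊔o y , m≤n⇒m≤o⊔n x ]) 0 _
        (inj₂ (Any.map ≤-reflexive (∈-map⁺ length (∈-filter⁺ (equilateral? d) S'∈sublists S'-eq)))))
    where
      S'-eq : Equilateral d S'
      S'-eq = Permutation.AllPairs-resp-↭ (setoid _) (λ {x} {y} xy≡d → trans (ham-sym y x) xy≡d)
                (resp₂ (λ x y → ham x y ≡ d)) (↭⇒↭ₛ S↭S') S-eq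

module Sylvester where

  open EquilateralSize using (e-maximal)
  open import Data.Nat using (zero; _≤_; _+_; _∸_; z≤n; s≤s)
  open import Data.Nat.Properties using (≤-trans; m≤m+n; +-mono-≤; +-suc; m∸n+n≡m)
  open import Data.Bool using (Bool; true; false; not)
  open import Data.Vec as Vec using (Vec; []; _∷_; _++_; replicate)
  open import Data.List as List using (List; []; _∷_; length; map)
  open import Data.List.Properties using (length-++; length-map)
  open import Data.List.Relation.Unary.All using (All; []; _∷_)
  open import Data.List.Relation.Unary.AllPairs as AllPairs using ([]; _∷_)
  import Data.List.Relation.Unary.AllPairs.Properties as AllPairs
  open import Relation.Binary.PropositionalEquality

  -- 2^t, defined so that vectors of length 2^(t+1) split into two halves of length 2^t.
  pow2 : ℕ → ℕ
  pow2 zero    = 1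
  pow2 (suc t) = pow2 t + pow2 t

  pow2-positive : ∀ t → 1 ≤ pow2 t
  pow2-positive zero    = s≤s z≤n
  pow2-positive (suc t) = ≤-trans (pow2-positive t) (m≤m+n _ _)

  pow2-large : ∀ t → suc t ≤ pow2 t
  pow2-large zero    = s≤s z≤n
  pow2-large (suc t) = +-mono-≤ (pow2-positive t) (pow2-large t)

  complement : ∀ {m} → Vec Bool m → Vec Bool m
  complement = Vec.map not

  ham-++ : ∀ {m k} (x x' : Vec Bool m) (y y' : Vec Bool k) → ham (x ++ y) (x' ++ y') ≡ ham x x' + ham y y'
  ham-++ []          []           y y' = refl
  ham-++ (true ∷ x)  (true ∷ x')  y y' = ham-++ x x' y y'
  ham-++ (false ∷ x) (false ∷ x') y y' = ham-++ x x' y y'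
  ham-++ (true ∷ x)  (false ∷ x') y y' = cong suc (ham-++ x x' y y')
  ham-++ (false ∷ x) (true ∷ x')  y y' = cong suc (ham-++ x x' y y')

  ham-complement : ∀ {m} (x y : Vec Bool m) → ham (complement x) (complement y) ≡ ham x y
  ham-complement []          []          = refl
  ham-complement (true ∷ x)  (true ∷ y)  = ham-complement x y
  ham-complement (false ∷ x) (false ∷ y) = ham-complement x y
  ham-complement (true ∷ x)  (false ∷ y) = cong suc (ham-complement x y)
  ham-complement (false ∷ x) (true ∷ y)  = cong suc (ham-complement x y)

  -- Every coordinate differs either from y or from its complement.
  ham-to-complement : ∀ {m} (x y : Vec Bool m) → ham x y + ham x (complement y) ≡ m
  ham-to-complement []          []          = refl
  ham-to-complement (true ∷ x)  (true ∷ y)  = trans (+-suc _ _) (cong suc (ham-to-complement x y))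
  ham-to-complement (false ∷ x) (false ∷ y) = trans (+-suc _ _) (cong suc (ham-to-complement x y))
  ham-to-complement (true ∷ x)  (false ∷ y) = cong suc (ham-to-complement x y)
  ham-to-complement (false ∷ x) (true ∷ y)  = cong suc (ham-to-complement x y)

  -- Sylvester's Hadamard matrices as lists of ±1 rows:  H₀ = (+),
  -- H_{t+1} = rows  x x  and  x x̄  for the rows x of H_t.
  hadamard : ∀ t → List (Vec Bool (pow2 t))
  hadamard zero    = (true ∷ []) ∷ []
  hadamard (suc t) = map (λ x → x ++ x) (hadamard t) List.++ map (λ x → x ++ complement x) (hadamard t)

  hadamard-size : ∀ t → length (hadamard t) ≡ pow2 t
  hadamard-size zero    = refl
  hadamard-size (suc t) = trans (length-++ (map (λ x → x ++ x) (hadamard t)))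
    (cong₂ _+_ (trans (length-map _ (hadamard t)) (hadamard-size t)) (trans (length-map _ (hadamard t)) (hadamard-size t)))

  private
    all-cross : ∀ {A B : Set} {R : B → B → Set} (f g : A → B) → (∀ x y → R (f x) (g y)) → ∀ xs ys →
      All (λ a → All (R a) (map g ys)) (map f xs)
    all-cross f g r []       ys = []
    all-cross f g r (x ∷ xs) ys = row ys ∷ all-cross f g r xs ys
      where row : ∀ zs → All _ (map g zs)
            row []       = []
            row (z ∷ zs) = r x z ∷ row zs

  -- The rows of H_{t+1} are pairwise at distance 2^t (orthogonality of ±1 rows).
  hadamard-equilateral : ∀ t → Equilateral (pow2 t) (hadamard (suc t))
  hadamard-equilateral zero    = (refl ∷ []) ∷ [] ∷ []
  hadamard-equilateral (suc t) = AllPairs.++⁺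
    (AllPairs.map⁺ (AllPairs.map (λ {x} {y} xy → trans (ham-++ x y x y) (cong₂ _+_ xy xy)) (hadamard-equilateral t)))
    (AllPairs.map⁺ (AllPairs.map (λ {x} {y} xy → trans (ham-++ x y (complement x) (complement y))
                                                     (cong₂ _+_ xy (trans (ham-complement x y) xy)))
                                 (hadamard-equilateral t)))
    (all-cross _ _ (λ x y → trans (ham-++ x y x (complement y)) (ham-to-complement x y))
               (hadamard (suc t)) (hadamard (suc t)))

  pad : ∀ p {m} → Vec Bool m → Vec Bool (p + m)
  pad p x = replicate p false ++ x

  ham-pad : ∀ p {m} (x y : Vec Bool m) → ham (pad p x) (pad p y) ≡ ham x y
  ham-pad zero    x y = refl
  ham-pad (suc p) x y = ham-pad p x y

  hadamard-lower-bound : ∀ t n → pow2 (suc t) ≤ n → pow2 (suc t) ≤ e (pow2 t) n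
  hadamard-lower-bound t n 2^t+1≤n = subst (λ k → pow2 (suc t) ≤ e (pow2 t) k) (m∸n+n≡m 2^t+1≤n)
    (subst (_≤ e (pow2 t) (p + pow2 (suc t))) size
      (e-maximal (pow2 t) (p + pow2 (suc t)) rows (pow2-positive t)
         (AllPairs.map⁺ (AllPairs.map (λ {x} {y} xy → trans (ham-pad p x y) xy) (hadamard-equilateral t)))))
    where
      p    = n ∸ pow2 (suc t)
      rows = map (pad p) (hadamard (suc t))
      size : length rows ≡ pow2 (suc t)
      size = trans (length-map (pad p) (hadamard (suc t))) (hadamard-size (suc t))

module Fractions where

  import Data.Nat as ℕ
  import Data.Nat.Properties as ℕP
  open import Data.Integer as ℤ using (+_; +<+; -[1+_]; +[1+_])
  open import Data.Integer.Properties using (pos-*; drop‿+<+; *-identityˡ)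
  open import Data.Rational using (ℚ; mkℚ; _/_; _<_; _≤_; _*_; ½; 0ℚ; ↥_; ↧_; toℚᵘ; *<*)
  open import Data.Rational.Properties using (toℚᵘ-mono-<; toℚᵘ-cancel-<; toℚᵘ-fromℚᵘ; toℚᵘ-homo-*; ↥p/↧p≡p; ≮⇒≥; ≤-<-trans; <-irrefl)
  import Data.Rational.Unnormalised.Base as ℚᵘ
  import Data.Rational.Unnormalised.Properties as ℚᵘ
  open import Data.Product using (∃₂; _,_)
  open import Function.Bundles using (_⇔_; mk⇔; Equivalence)
  open import Relation.Binary.PropositionalEquality

  frac<frac : ∀ i m j m' → (i / suc m < j / suc m') ⇔ (i ℤ.* + suc m' ℤ.< j ℤ.* + suc m)
  frac<frac i m j m' = mk⇔
    (λ lt → ℚᵘ.drop-*<* (ℚᵘ.<-respˡ-≃ (as-ᵘ i m) (ℚᵘ.<-respʳ-≃ (as-ᵘ j m') (toℚᵘ-mono-< lt))))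
    (λ lt → toℚᵘ-cancel-< (ℚᵘ.<-respˡ-≃ (ℚᵘ.≃-sym (as-ᵘ i m)) (ℚᵘ.<-respʳ-≃ (ℚᵘ.≃-sym (as-ᵘ j m')) (ℚᵘ.*<* lt))))
    where as-ᵘ : ∀ i m → toℚᵘ (i / suc m) ℚᵘ.≃ ℚᵘ.mkℚᵘ i m
          as-ᵘ i m = toℚᵘ-fromℚᵘ (ℚᵘ.mkℚᵘ i m)

  -- Every rational p is the fraction ↥p/↧p, so the same applies to comparisons p < j/(m+1).
  <frac : ∀ p j m → (p < j / suc m) ⇔ (↥ p ℤ.* + suc m ℤ.< j ℤ.* ↧ p)
  <frac p j m = subst (λ q → (q < j / suc m) ⇔ (↥ p ℤ.* + suc m ℤ.< j ℤ.* ↧ p)) (↥p/↧p≡p p) (frac<frac (↥ p) (ℚ.denominator-1 p) j m)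

  ℕfrac<frac : ∀ a m b m' → (+ a / suc m < + b / suc m') ⇔ (a ℕ.* suc m' ℕ.< b ℕ.* suc m)
  ℕfrac<frac a m b m' = mk⇔
    (λ lt → drop‿+<+ (subst₂ ℤ._<_ (sym (pos-* a (suc m'))) (sym (pos-* b (suc m))) (Equivalence.to (frac<frac (+ a) m (+ b) m') lt)))
    (λ lt → Equivalence.from (frac<frac (+ a) m (+ b) m') (subst₂ ℤ._<_ (pos-* a (suc m')) (pos-* b (suc m)) (+<+ lt)))

  ℕfrac≤frac : ∀ a m b m' → (+ a / suc m ≤ + b / suc m') ⇔ (a ℕ.* suc m' ℕ.≤ b ℕ.* suc m)
  ℕfrac≤frac a m b m' = mk⇔
    (λ le → ℕP.≮⇒≥ (λ lt → <-irrefl refl (≤-<-trans le (Equivalence.from (ℕfrac<frac b m' a m) lt))))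
    (λ le → ≮⇒≥ (λ lt → ℕP.≤⇒≯ le (Equivalence.to (ℕfrac<frac b m' a m) lt)))

  half< : ∀ p q → ½ * p < q → ↥ p ℤ.* ↧ q ℤ.< ↥ q ℤ.* (+ 2 ℤ.* ↧ p)
  half< p@(mkℚ _ _ _) q@(mkℚ _ _ _) lt = subst (λ x → x ℤ.* ↧ q ℤ.< _) (*-identityˡ (↥ p))
    (ℚᵘ.drop-*<* (ℚᵘ.<-respˡ-≃ (toℚᵘ-homo-* ½ p) (toℚᵘ-mono-< lt)))

  positive-fraction : ∀ q → 0ℚ < q → ∃₂ λ A B → q ≡ + suc A / suc B
  positive-fraction q@(mkℚ +[1+ A ] B _) _ = A , B , sym (↥p/↧p≡p q)
  positive-fraction (mkℚ (+ 0) _ _)     (*<* (+<+ ()))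
  positive-fraction (mkℚ -[1+ _ ] _ _)  (*<* ())

module Estimates where

  open import Data.Nat using (zero; _≤_; _<_; _+_; _*_; z≤n; s≤s)
  open import Data.Nat.Properties
  open import Data.Nat.Tactic.RingSolver using (solve-∀)
  open import Data.Product using (∃; _,_)
  open import Data.Empty using (⊥-elim)
  open import Relation.Nullary using (yes; no)
  open import Relation.Binary.PropositionalEquality
  open ≤-Reasoning

  intermediate-value : ∀ (f : ℕ → ℕ) → (∀ m → f (suc m) ≤ suc (f m)) →
    ∀ T m₀ → f 0 < T → T ≤ f m₀ → ∃ λ m → f m ≡ T
  intermediate-value f step T zero      f0<T T≤f = ⊥-elim (<⇒≱ f0<T T≤f)
  intermediate-value f step T (suc m₀) f0<T T≤f with T ≤? f m₀
  ... | yes T≤f' = intermediate-value f step T m₀ f0<T T≤f'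
  ... | no  T≰f' = suc m₀ , ≤-antisym (≤-trans (step m₀) (≰⇒> T≰f')) T≤f

  -- ⌊γn⌋ grows by at most one from n to n + 1 when γ ≤ ½:  if k'/(n+1) < (k+1)/n
  -- and 2k ≤ n, then k' ≤ k + 1.
  floor-step-bound : ∀ k k' m → k' * suc m < suc k * suc (suc m) → 2 * k ≤ suc m → k' ≤ suc k
  floor-step-bound k k' m k'n< 2k≤n with k' ≤? suc k
  ... | yes k'≤ = k'≤
  ... | no  k'≰ = ⊥-elim (<-irrefl refl (begin-strict
    k          <⟨ m<m+n k (≤-trans (s≤s z≤n) k>m) ⟩
    k + k      ≡⟨ cong (k +_) (+-identityʳ k) ⟨
    2 * k      ≤⟨ 2k≤n ⟩
    suc m      ≤⟨ k>m ⟩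
    k          ∎))
    where
      k>m : suc m ≤ k
      k>m = ≤-pred (+-cancelˡ-< (suc k * suc m) (suc m) (suc k) (begin-strict
        suc k * suc m + suc m         ≡⟨ +-comm (suc k * suc m) (suc m) ⟩
        suc (suc k) * suc m           ≤⟨ *-monoˡ-≤ (suc m) (≰⇒> k'≰) ⟩
        k' * suc m                    <⟨ k'n< ⟩
        suc k * suc (suc m)           ≡⟨ *-suc (suc k) (suc m) ⟩
        suc k + suc k * suc m         ≡⟨ +-comm (suc k) (suc k * suc m) ⟩
        suc k * suc m + suc k         ∎))

  -- The remaining estimates bound e_k(n) for γ > ½.  With s = S/B a rational in (½, γ),
  -- the floor k = ⌊γn⌋ exceeds n/2 by a positive proportion of n ...
  floor-gap : ∀ B S k n → B < S * 2 → S * n < suc k * B → B * n + n < 2 * k * B + 2 * B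
  floor-gap B S k n B<2S s<[k+1]/n = begin-strict
    B * n + n             ≡⟨ +-comm (B * n) n ⟩
    suc B * n             ≤⟨ *-monoˡ-≤ n B<2S ⟩
    S * 2 * n             ≡⟨ regroup S n ⟩
    2 * (S * n)           <⟨ *-monoʳ-< 2 s<[k+1]/n ⟩
    2 * (suc k * B)       ≡⟨ expand k B ⟩
    2 * k * B + 2 * B     ∎
    where regroup : ∀ S n → S * 2 * n ≡ 2 * (S * n)
          regroup = solve-∀
          expand : ∀ k B → 2 * (suc k * B) ≡ 2 * k * B + 2 * B
          expand = solve-∀

  -- ... so the Plotkin bound 2kE ≤ 2k + nE caps E:  nE ≤ 2nB + 2BE ...
  plotkin-estimate : ∀ B k n E → B * n + n ≤ 2 * k * B + 2 * B → 2 * k * E ≤ 2 * k + n * E → k ≤ n →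
    n * E ≤ 2 * n * B + 2 * B * E
  plotkin-estimate B k n E gap plotkin k≤n = begin
    n * E                          ≤⟨ +-cancelˡ-≤ (B * n * E) (n * E) (2 * k * B + 2 * B * E) bound ⟩
    2 * k * B + 2 * B * E          ≤⟨ +-monoˡ-≤ (2 * B * E) (*-monoˡ-≤ B (*-monoʳ-≤ 2 k≤n)) ⟩
    2 * n * B + 2 * B * E          ∎
    where
      e₁ : ∀ B n E → B * n * E + n * E ≡ (B * n + n) * E
      e₁ = solve-∀
      e₂ : ∀ k B E → (2 * k * B + 2 * B) * E ≡ B * (2 * k * E) + 2 * B * E
      e₂ = solve-∀
      e₃ : ∀ k B n E → B * (2 * k + n * E) + 2 * B * E ≡ B * n * E + (2 * k * B + 2 * B * E)
      e₃ = solve-∀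
      bound : B * n * E + n * E ≤ B * n * E + (2 * k * B + 2 * B * E)
      bound = begin
        B * n * E + n * E              ≡⟨ e₁ B n E ⟩
        (B * n + n) * E                ≤⟨ *-monoˡ-≤ E gap ⟩
        (2 * k * B + 2 * B) * E        ≡⟨ e₂ k B E ⟩
        B * (2 * k * E) + 2 * B * E    ≤⟨ +-monoˡ-≤ (2 * B * E) (*-monoʳ-≤ B plotkin) ⟩
        B * (2 * k + n * E) + 2 * B * E ≡⟨ e₃ k B n E ⟩
        B * n * E + (2 * k * B + 2 * B * E) ∎

  -- ... which for n ≥ 4B forces E ≤ 4B.
  bounded-size : ∀ B n E → n * E ≤ 2 * n * B + 2 * B * E → 4 * B ≤ n → 1 ≤ n → E ≤ 4 * B
  bounded-size B n E estimate 4B≤n 1≤n with E ≤? 4 * B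
  ... | yes E≤4B = E≤4B
  ... | no  E≰4B = ⊥-elim (<-irrefl refl (begin-strict
    4 * n * B + 4 * B * E          ≡⟨ e₁ n B E ⟩
    n * (4 * B) + 4 * B * E        <⟨ +-monoˡ-< (4 * B * E) (m<n+m (n * (4 * B)) 1≤n) ⟩
    n + n * (4 * B) + 4 * B * E    ≡⟨ cong (_+ 4 * B * E) (*-suc n (4 * B)) ⟨
    n * suc (4 * B) + 4 * B * E    ≤⟨ +-mono-≤ (*-monoʳ-≤ n (≰⇒> E≰4B)) (*-monoˡ-≤ E 4B≤n) ⟩
    n * E + n * E                  ≤⟨ +-mono-≤ estimate estimate ⟩
    2 * n * B + 2 * B * E + (2 * n * B + 2 * B * E) ≡⟨ e₂ n B E ⟩
    4 * n * B + 4 * B * E          ∎))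
    where
      e₁ : ∀ n B E → 4 * n * B + 4 * B * E ≡ n * (4 * B) + 4 * B * E
      e₁ = solve-∀
      e₂ : ∀ n B E → 2 * n * B + 2 * B * E + (2 * n * B + 2 * B * E) ≡ 4 * n * B + 4 * B * E
      e₂ = solve-∀


module GapEstimate where

  open import Data.Integer using (ℤ; +_; _+_; _*_; -_; _<_; _≤_)
  open import Data.Integer.Properties
    using (*-cancelʳ-<-nonNeg; *-monoʳ-<-pos; *-monoˡ-≤-nonNeg; +-monoʳ-≤; +-monoˡ-<; i<j⇒suc[i]≤j; module ≤-Reasoning)
  open import Data.Integer.Tactic.RingSolver using (solve-∀)
  open import Relation.Binary.PropositionalEquality
  open ≤-Reasoning

  -- If r = R/(d+1) < 2s, s = S/(b+1) < (k+1)/n and n ≥ 2(b+1)(d+1), then r < 2k/n: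
  -- the gap 2s − r is at least 1/((b+1)(d+1)) ≥ 2/n, while 2k/n > 2s − 2/n.
  double-floor : ∀ (R S k : ℤ) (b d n : ℕ) →
    R * + suc b < S * (+ 2 * + suc d) → S * + n < (+ 1 + k) * + suc b → + 2 * + suc b * + suc d ≤ + n →
    R * + n < + 2 * k * + suc d
  double-floor R S k b d n 2s>r s<[k+1]/n n≥2bd = *-cancelʳ-<-nonNeg B (cancel (begin-strict
    R * N * B + N                   ≡⟨ e₁ R B N ⟩
    N * (+ 1 + R * B)               ≤⟨ *-monoˡ-≤-nonNeg N (i<j⇒suc[i]≤j 2s>r) ⟩
    N * (S * (+ 2 * D))             ≡⟨ e₂ N S D ⟩
    S * N * (+ 2 * D)               <⟨ *-monoʳ-<-pos (+ 2 * D) s<[k+1]/n ⟩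
    (+ 1 + k) * B * (+ 2 * D)       ≡⟨ e₃ k B D ⟩
    + 2 * k * D * B + + 2 * B * D   ≤⟨ +-monoʳ-≤ (+ 2 * k * D * B) n≥2bd ⟩
    + 2 * k * D * B + N             ∎))
    where
      B = + suc b
      D = + suc d
      N = + n
      cancel : ∀ {x y} → x + N < y + N → x < y
      cancel {x} {y} lt = subst₂ _<_ (drop x N) (drop y N) (+-monoˡ-< (- N) lt)
        where drop : ∀ x n → x + n + - n ≡ x
              drop = solve-∀
      e₁ : ∀ R B N → R * N * B + N ≡ N * (+ 1 + R * B)
      e₁ = solve-∀
      e₂ : ∀ N S D → N * (S * (+ 2 * D)) ≡ S * N * (+ 2 * D)
      e₂ = solve-∀
      e₃ : ∀ k B D → (+ 1 + k) * B * (+ 2 * D) ≡ + 2 * k * D * B + + 2 * B * D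
      e₃ = solve-∀

module FloorSequence (γ : Real) (d : ℕ → ℕ) (floor : ∀ m → IsFloorMul γ (suc m) (d (suc m))) where

  open EquilateralBounds using (rank-bound; plotkin)
  open EquilateralSize using (e-attained)
  open Sylvester using (pow2; pow2-positive; pow2-large; hadamard-lower-bound)
  open Fractions
  open Estimates
  open GapEstimate using (double-floor)
  open import Data.Nat using (_≤_; _<_; _+_; _*_; z≤n; s≤s)
  open import Data.Nat.Properties
  open import Data.Integer as ℤ using (+_)
  import Data.Integer.Properties as ℤ
  open import Data.Rational as ℚ using (ℚ; _/_; ½; 0ℚ; 1ℚ; ↥_; ↧_; ↧ₙ_)
  import Data.Rational.Properties as ℚ
  open import Data.List using (length)
  open import Data.Product using (∃; _×_; _,_; proj₁; proj₂)
  open import Data.Empty using (⊥-elim)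
  open import Function.Bundles using (Equivalence)
  open import Relation.Nullary using (¬_; yes; no)
  open import Relation.Binary.PropositionalEquality

  -- For n = m + 1 write k m = ⌊γn⌋ and E m = e_{k m}(n), so that ratioSeq d m = E m / n.
  k : ℕ → ℕ
  k m = d (suc m)

  E : ℕ → ℕ
  E m = e (k m) (suc m)

  below-next : ∀ m {q} → Lower γ q → q ℚ.< + suc (k m) / suc m
  below-next m {q} q<γ with q ℚ.<? + suc (k m) / suc m
  ... | yes lt = lt
  ... | no  ≮  with proj₂ (floor m)
  ...   | q₀ , q₀<[k+1]/n , q₀≮γ = ⊥-elim (q₀≮γ (downClosed γ (ℚ.<-≤-trans q₀<[k+1]/n (ℚ.≮⇒≥ ≮)) q<γ))

  floor-below : ∀ m {q} → ¬ Lower γ q → + k m / suc m ℚ.≤ q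
  floor-below m {q} q≮γ = ℚ.≮⇒≥ (λ lt → q≮γ (proj₁ (floor m) q lt))

  floor≤half : ¬ Lower γ ½ → ∀ m → 2 * k m ≤ suc m
  floor≤half γ≤½ m = subst₂ _≤_ (*-comm (k m) 2) (*-identityˡ (suc m))
    (Equivalence.to (ℕfrac≤frac (k m) m 1 1) (floor-below m γ≤½))

  floor≤one : ¬ Lower γ 1ℚ → ∀ m → k m ≤ suc m
  floor≤one γ≤1 m = subst₂ _≤_ (*-identityʳ (k m)) (*-identityˡ (suc m))
    (Equivalence.to (ℕfrac≤frac (k m) m 1 0) (floor-below m γ≤1))

  floor-step : ¬ Lower γ ½ → ∀ m → k (suc m) ≤ suc (k m)
  floor-step γ≤½ m with proj₂ (floor m)
  ... | q₀ , q₀<[k+1]/n , q₀≮γ = floor-step-bound (k m) (k (suc m)) m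
          (Equivalence.to (ℕfrac<frac (k (suc m)) (suc m) (suc (k m)) m) (ℚ.≤-<-trans (floor-below (suc m) q₀≮γ) q₀<[k+1]/n))
          (floor≤half γ≤½ m)

  floor-grows : Lower γ 0ℚ → ∀ T → ∃ λ N → ∀ m → N ≤ m → T ≤ k m
  floor-grows 0<γ T with rounded γ 0<γ
  ... | q₀ , 0<q₀ , q₀<γ with positive-fraction q₀ 0<q₀
  ...   | A , B , refl = T * suc B , λ m N≤m → ≤-pred (*-cancelʳ-< (suc B) T (suc (k m)) (begin-strict
    T * suc B               ≤⟨ N≤m ⟩
    m                       <⟨ n<1+n m ⟩
    suc m                   ≤⟨ m≤n*m (suc m) (suc A) ⟩
    suc A * suc m           <⟨ Equivalence.to (ℕfrac<frac (suc A) B (suc (k m)) m) (below-next m q₀<γ) ⟩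
    suc (k m) * suc B       ∎))
    where open ≤-Reasoning

  floor-hits : Lower γ 0ℚ → ¬ Lower γ ½ → ∀ T → 1 ≤ T → ∃ λ m → k m ≡ T
  floor-hits 0<γ γ≤½ T 1≤T with floor-grows 0<γ T
  ... | N , T≤k = intermediate-value k (floor-step γ≤½) T N (<-≤-trans k0<1 1≤T) (T≤k N ≤-refl)
    where
      k0<1 : k 0 < 1
      k0<1 = *-cancelˡ-< 2 (k 0) 1 (s≤s (floor≤half γ≤½ 0))

  -- Part (1), upper bound: eventually 1 ≤ k ≤ n/2, so E ≤ n by the rank bound.
  size≤n : ¬ Lower γ ½ → ∀ m → 1 ≤ k m → E m ≤ suc m
  size≤n γ≤½ m 1≤k with e-attained (k m) (suc m)
  ... | S , S-eq , |S|≡E = subst (_≤ suc m) |S|≡E (rank-bound (k m) S 1≤k (floor≤half γ≤½ m) S-eq)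

  limsup≤1 : Lower γ 0ℚ → ¬ Lower γ ½ → LimsupLE (ratioSeq d) 1ℚ
  limsup≤1 0<γ γ≤½ r 1<r with floor-grows 0<γ 1
  ... | N , 1≤k = N , λ m N≤m → ℚ.≤-<-trans (ratio≤1 m (1≤k m N≤m)) 1<r
    where
      ratio≤1 : ∀ m → 1 ≤ k m → ratioSeq d m ℚ.≤ 1ℚ
      ratio≤1 m 1≤k = Equivalence.from (ℕfrac≤frac (E m) m 1 0)
        (subst₂ _≤_ (sym (*-identityʳ (E m))) (sym (*-identityˡ (suc m))) (size≤n γ≤½ m 1≤k))

  -- Part (1), lower bound.  First, 2k/n eventually exceeds every r with ½r < s < γ.
  twice-floor-above : ∀ {r s} m → ½ ℚ.* r ℚ.< s → Lower γ s → 2 * ↧ₙ s * ↧ₙ r ≤ suc m → r ℚ.< + (2 * k m) / suc m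
  twice-floor-above {r} {s} m ½r<s s<γ n≥2sr = Equivalence.from (<frac r (+ (2 * k m)) m)
    (subst (λ x → ↥ r ℤ.* + suc m ℤ.< x ℤ.* ↧ r) (sym (ℤ.pos-* 2 (k m)))
      (double-floor (↥ r) (↥ s) (+ k m) (ℚ.denominator-1 s) (ℚ.denominator-1 r) (suc m)
        (half< r s ½r<s) (Equivalence.to (<frac s (+ suc (k m)) m) (below-next m s<γ))
        (subst (ℤ._≤ + suc m) cast (ℤ.+≤+ n≥2sr))))
    where
      cast : + (2 * ↧ₙ s * ↧ₙ r) ≡ + 2 ℤ.* ↧ s ℤ.* ↧ r
      cast = trans (ℤ.pos-* (2 * ↧ₙ s) (↧ₙ r)) (cong (ℤ._* ↧ r) (ℤ.pos-* 2 (↧ₙ s)))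

  -- Second, where k = 2^t we have n ≥ 2^(t+1) and, by Sylvester's construction, E ≥ 2k.
  hadamard-point : ¬ Lower γ ½ → ∀ t m → k m ≡ pow2 t → pow2 (suc t) ≤ suc m × 2 * k m ≤ E m
  hadamard-point γ≤½ t m k≡2ᵗ =
    n≥2ᵗ⁺¹ , subst (λ x → 2 * x ≤ e x (suc m)) (sym k≡2ᵗ)
                   (subst (_≤ e (pow2 t) (suc m)) double (hadamard-lower-bound t (suc m) n≥2ᵗ⁺¹))
    where
      double : pow2 (suc t) ≡ 2 * pow2 t
      double = cong (_+_ (pow2 t)) (sym (+-identityʳ (pow2 t)))
      n≥2ᵗ⁺¹ : pow2 (suc t) ≤ suc m
      n≥2ᵗ⁺¹ = subst (_≤ suc m) (trans (cong (2 *_) k≡2ᵗ) (sym double)) (floor≤half γ≤½ m)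

  -- Along the (arbitrarily late) points where k is a large power of two, E/n ≥ 2k/n > r.
  limsup≥2γ : Lower γ 0ℚ → ¬ Lower γ ½ → LimsupGE (ratioSeq d) (λ r → Lower γ (½ ℚ.* r))
  limsup≥2γ 0<γ γ≤½ r ½r<γ N with rounded γ ½r<γ
  ... | s , ½r<s , s<γ = late (floor-hits 0<γ γ≤½ (pow2 t) (pow2-positive t))
    where
      t = N + 2 * ↧ₙ s * ↧ₙ r
      late : ∃ (λ m → k m ≡ pow2 t) → ∃ λ m → N ≤ m × r ℚ.< ratioSeq d m
      late (m , k≡2ᵗ) = m , N≤m , ℚ.<-≤-trans (twice-floor-above m ½r<s s<γ n≥2sr) 2k/n≤E/n
        where
          n≥2ᵗ⁺¹ = proj₁ (hadamard-point γ≤½ t m k≡2ᵗ)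
          t<n : suc t ≤ suc m
          t<n = ≤-trans (pow2-large t) (≤-trans (m≤m+n _ _) n≥2ᵗ⁺¹)
          N≤m : N ≤ m
          N≤m = ≤-trans (m≤m+n N _) (≤-pred t<n)
          n≥2sr : 2 * ↧ₙ s * ↧ₙ r ≤ suc m
          n≥2sr = ≤-trans (m≤n+m _ N) (≤-trans (n≤1+n t) t<n)
          2k/n≤E/n : + (2 * k m) / suc m ℚ.≤ ratioSeq d m
          2k/n≤E/n = Equivalence.from (ℕfrac≤frac (2 * k m) m (E m) m)
                       (*-monoˡ-≤ (suc m) (proj₂ (hadamard-point γ≤½ t m k≡2ᵗ)))

  -- Part (2): for ½ < γ ≤ 1 the sizes E stay bounded, by the Plotkin bound.
  private
    0<½ : 0ℚ ℚ.< ½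
    0<½ = Equivalence.from (ℕfrac<frac 0 0 1 1) (s≤s z≤n)

  size-bounded : Lower γ ½ → ¬ Lower γ 1ℚ → ∃ λ B → ∀ m → 4 * B ≤ suc m → E m ≤ 4 * B
  size-bounded ½<γ γ≤1 with rounded γ ½<γ
  ... | s , ½<s , s<γ with positive-fraction s (ℚ.<-trans 0<½ ½<s)
  ...   | S , B , refl = suc B , bound
    where
      B<2S : suc B < suc S * 2
      B<2S = subst (_< suc S * 2) (*-identityˡ (suc B)) (Equivalence.to (ℕfrac<frac 1 1 (suc S) B) ½<s)
      bound : ∀ m → 4 * suc B ≤ suc m → E m ≤ 4 * suc B
      bound m 4B≤n with e-attained (k m) (suc m)
      ... | T , T-eq , |T|≡E = subst (_≤ 4 * suc B) |T|≡E
        (bounded-size (suc B) (suc m) (length T)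
          (plotkin-estimate (suc B) (k m) (suc m) (length T)
            (<⇒≤ (floor-gap (suc B) (suc S) (k m) (suc m) B<2S
              (Equivalence.to (ℕfrac<frac (suc S) B (suc (k m)) m) (below-next m s<γ))))
            (plotkin (k m) T T-eq) (floor≤one γ≤1 m))
          4B≤n (s≤s z≤n))

  limsup≤0 : Lower γ ½ → ¬ Lower γ 1ℚ → LimsupLE (ratioSeq d) 0ℚ
  limsup≤0 ½<γ γ≤1 r 0<r with size-bounded ½<γ γ≤1 | positive-fraction r 0<r
  ... | B , bounded | R , D , refl = 4 * B * suc D , λ m N≤m →
    Equivalence.from (ℕfrac<frac (E m) m (suc R) D) (begin-strict
      E m * suc D         ≤⟨ *-monoˡ-≤ (suc D) (bounded m (≤-trans (m≤m*n (4 * B) (suc D)) (≤-trans N≤m (n≤1+n m)))) ⟩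
      4 * B * suc D       ≤⟨ N≤m ⟩
      m                   <⟨ n<1+n m ⟩
      suc m               ≤⟨ m≤n*m (suc m) (suc R) ⟩
      suc R * suc m       ∎)
    where open ≤-Reasoning

  -- The ratios are nonnegative, so every negative r lies below all of them.
  above-negatives : LimsupGE (ratioSeq d) (λ r → r ℚ.< 0ℚ)
  above-negatives r r<0 N = N , ≤-refl , ℚ.<-≤-trans r<0 (Equivalence.from (ℕfrac≤frac 0 0 (E N) N) z≤n)

open import Data.Rational using (ℚ; _<_; _*_; ½; 0ℚ; 1ℚ)
open import Data.Product using (_×_; _,_)
open import Relation.Nullary using (¬_)

theorem3p1 : (γ : Real) → (d : ℕ → ℕ) → (∀ m → IsFloorMul γ (suc m) (d (suc m)))
    → ((Lower γ 0ℚ → ¬ Lower γ ½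
    → LimsupGE (ratioSeq d) (λ r → Lower γ (½ * r)) × LimsupLE (ratioSeq d) 1ℚ)
    × (Lower γ ½ → ¬ Lower γ 1ℚ
    → LimsupGE (ratioSeq d) (λ r → r < 0ℚ) × LimsupLE (ratioSeq d) 0ℚ))
theorem3p1 γ d floor =
  (λ 0<γ γ≤½ → limsup≥2γ 0<γ γ≤½ , limsup≤1 0<γ γ≤½) ,
  (λ ½<γ γ≤1 → above-negatives , limsup≤0 ½<γ γ≤1)
  where open FloorSequence γ d floor
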